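{- Let $G$ be the graph on the $18$ vertices $p_1,\dots,p_5,d_1,\dots,d_5,v_1,\dots,v_5,w_1,w_2,w_3$ with edges $p_3d_3, p_3d_2, p_3p_2, p_3p_4, d_3p_4, d_3v_4, d_3v_3, d_2p_2, d_2v_3, d_2v_2, p_2d_1, p_2p_1, p_4p_5, p_4d_4, v_4v_3, v_4d_4, v_4v_5, v_3v_2, v_2d_1, v_2v_1, d_1p_1, d_1v_1, p_1p_5, p_1d_5, p_5d_4, p_5d_5, d_4v_5, v_5w_1, v_5w_2, v_1w_2, v_1w_3, d_5w_1, d_5w_3$. Then the injective chromatic number of $G$ is at least $8$.
   Context: An injective $k$-colouring of a graph $G$ is a map $c:V(G)\to\{1,\dots,k\}$ such that any two distinct vertices with a common neighbour get different colours; the injective chromatic number $\chi_i(G)$ is the least such $k$. -}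

module Defs where

open import Data.Nat using (ℕ)
open import Data.Fin using (Fin)
open import Data.Product using (_×_)
open import Relation.Binary.PropositionalEquality using (_≡_)
open import Relation.Nullary using (¬_)

data V : Set where
  p1 p2 p3 p4 p5 d1 d2 d3 d4 d5 v1 v2 v3 v4 v5 w1 w2 w3 : V

data Edge : V → V → Set where
  e01 : Edge p3 d3
  e02 : Edge p3 d2
  e03 : Edge p3 p2
  e04 : Edge p3 p4
  e05 : Edge d3 p4
  e06 : Edge d3 v4
  e07 : Edge d3 v3
  e08 : Edge d2 p2
  e09 : Edge d2 v3
  e10 : Edge d2 v2
  e11 : Edge p2 d1
  e12 : Edge p2 p1
  e13 : Edge p4 p5
  e14 : Edge p4 d4
  e15 : Edge v4 v3
  e16 : Edge v4 d4
  e17 : Edge v4 v5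
  e18 : Edge v3 v2
  e19 : Edge v2 d1
  e20 : Edge v2 v1
  e21 : Edge d1 p1
  e22 : Edge d1 v1
  e23 : Edge p1 p5
  e24 : Edge p1 d5
  e25 : Edge p5 d4
  e26 : Edge p5 d5
  e27 : Edge d4 v5
  e28 : Edge v5 w1
  e29 : Edge v5 w2
  e30 : Edge v1 w2
  e31 : Edge v1 w3
  e32 : Edge d5 w1
  e33 : Edge d5 w3

data Adj : V → V → Set where
  fwd : ∀ {x y} → Edge x y → Adj x y
  bwd : ∀ {x y} → Edge y x → Adj x y

IsInjectiveColouring : (k : ℕ) → (V → Fin k) → Set
IsInjectiveColouring k c =
  ∀ (x y z : V) → ¬ (x ≡ y) → Adj x z → Adj y z → ¬ (c x ≡ c y)

{-# OPTIONS --safe #-}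

-- Two vertices conflict when they are distinct and have a common neighbour, and an injective
-- colouring separates conflicting vertices.  Among the fifteen vertices p_i, d_i, v_i every
-- three contain a conflicting pair, so no colour occurs more than twice on them and 15 ≤ 2k.
-- For the count, tag each point with its colour and with whether that colour already occurred
-- at an earlier point: with at most two points per colour this tagging is injective.

module Submission where

open import Defs
open import Data.Nat using (ℕ; _≤_; _*_; s≤s)
open import Data.Nat.Properties using (≮⇒≥; ≤-pred; *-monoˡ-≤; <⇒≱)
open import Data.Empty using (⊥)
open import Data.Fin using (Fin; _<_; _<?_; combine; #_)
open import Data.Fin.Properties using (injective⇒≤; combine-injective; <-cmp; any?; all?)
import Data.Fin.Properties as Fin
open import Data.Bool using (if_then_else_)
open import Data.List using (List; []; _∷_; map)
open import Data.List.Relation.Unary.Any using (Any; satisfied)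
import Data.List.Relation.Unary.Any as Any
open import Data.List.Membership.Propositional using (_∈_)
open import Data.List.Membership.Propositional.Properties using (∈-map⁻)
open import Data.Vec using (Vec; []; _∷_; lookup; take)
open import Data.Product using (∃; ∃-syntax; _×_; _,_; proj₁; proj₂)
open import Data.Sum using (_⊎_; inj₁; inj₂)
import Data.Sum as Sum
open import Function using (_∘_)
open import Function.Definitions using (Injective)
open import Relation.Binary using (DecidableEquality; tri<; tri≈; tri>)
open import Relation.Binary.PropositionalEquality using (_≡_; _≢_; refl; sym; trans; cong; module ≡-Reasoning)
open import Relation.Nullary using (¬_; does; contradiction)
open import Relation.Nullary.Decidable using (Dec; map′; dec-true; dec-false; from-yes; _×-dec_; _⊎-dec_; _→-dec_; ¬?)

module _ {n k : ℕ} (f : Fin n → Fin k) where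

  AtMostTwoToOne : Set
  AtMostTwoToOne = ∀ {i j l} → i < j → j < l → f i ≡ f j → f j ≡ f l → ⊥

  Repeated : Fin n → Set
  Repeated j = ∃[ i ] (i < j × f i ≡ f j)

  repeated? : (j : Fin n) → Dec (Repeated j)
  repeated? j = any? λ i → (i <? j) ×-dec (f i Fin.≟ f j)

  repeatedBit : Fin n → Fin 2
  repeatedBit i = if does (repeated? i) then # 1 else # 0

  repeatedBit-yes : ∀ {i} → Repeated i → repeatedBit i ≡ # 1
  repeatedBit-yes {i} r = cong (λ b → if b then # 1 else # 0) (dec-true (repeated? i) r)

  repeatedBit-no : ∀ {i} → ¬ Repeated i → repeatedBit i ≡ # 0
  repeatedBit-no {i} ¬r = cong (λ b → if b then # 1 else # 0) (dec-false (repeated? i) ¬r)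

  marked : Fin n → Fin (k * 2)
  marked i = combine (f i) (repeatedBit i)

  module _ (two-to-one : AtMostTwoToOne) where

    marks-differ : ∀ {i j} → i < j → f i ≡ f j → marked i ≢ marked j
    marks-differ {i} {j} i<j fi≡fj marks≡ = 0≢1 (begin
        # 0           ≡⟨ sym (repeatedBit-no (λ (h , h<i , fh≡fi) → two-to-one h<i i<j fh≡fi fi≡fj)) ⟩
        repeatedBit i ≡⟨ proj₂ (combine-injective (f i) _ (f j) _ marks≡) ⟩
        repeatedBit j ≡⟨ repeatedBit-yes (i , i<j , fi≡fj) ⟩
        # 1           ∎)
      where
      open ≡-Reasoning
      0≢1 : # 0 ≢ # 1
      0≢1 ()

    marked-injective : Injective _≡_ _≡_ marked
    marked-injective {i} {j} marks≡
      with <-cmp i j | proj₁ (combine-injective (f i) _ (f j) _ marks≡)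
    ... | tri< i<j _ _ | fi≡fj = contradiction marks≡ (marks-differ i<j fi≡fj)
    ... | tri≈ _ i≡j _ | _     = i≡j
    ... | tri> _ _ j<i | fi≡fj = contradiction (sym marks≡) (marks-differ j<i (sym fi≡fj))

atMostTwoToOne⇒≤ : ∀ {n k} (f : Fin n → Fin k) → AtMostTwoToOne f → n ≤ k * 2
atMostTwoToOne⇒≤ f two-to-one = injective⇒≤ (marked-injective f two-to-one)

Adj-sym : ∀ {x y} → Adj x y → Adj y x
Adj-sym (fwd e) = bwd e
Adj-sym (bwd e) = fwd e

vertices : Vec V 18
vertices = p1 ∷ p2 ∷ p3 ∷ p4 ∷ p5 ∷ d1 ∷ d2 ∷ d3 ∷ d4 ∷ d5 ∷ v1 ∷ v2 ∷ v3 ∷ v4 ∷ v5 ∷ w1 ∷ w2 ∷ w3 ∷ []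

position : V → Fin 18
position = λ
  { p1 → # 0  ; p2 → # 1  ; p3 → # 2  ; p4 → # 3  ; p5 → # 4
  ; d1 → # 5  ; d2 → # 6  ; d3 → # 7  ; d4 → # 8  ; d5 → # 9
  ; v1 → # 10 ; v2 → # 11 ; v3 → # 12 ; v4 → # 13 ; v5 → # 14
  ; w1 → # 15 ; w2 → # 16 ; w3 → # 17 }

lookup-position : ∀ x → lookup vertices (position x) ≡ x
lookup-position = λ
  { p1 → refl ; p2 → refl ; p3 → refl ; p4 → refl ; p5 → refl
  ; d1 → refl ; d2 → refl ; d3 → refl ; d4 → refl ; d5 → refl
  ; v1 → refl ; v2 → refl ; v3 → refl ; v4 → refl ; v5 → refl
  ; w1 → refl ; w2 → refl ; w3 → refl }

position-injective : Injective _≡_ _≡_ position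
position-injective {x} {y} eq =
  trans (sym (lookup-position x)) (trans (cong (lookup vertices) eq) (lookup-position y))

_≟_ : DecidableEquality V
x ≟ y = map′ position-injective (cong position) (position x Fin.≟ position y)

neighbourhood : (x : V) → List (∃ (Adj x))
neighbourhood p1 = (p2 , bwd e12) ∷ (p5 , fwd e23) ∷ (d1 , bwd e21) ∷ (d5 , fwd e24) ∷ []
neighbourhood p2 = (p1 , fwd e12) ∷ (p3 , bwd e03) ∷ (d1 , fwd e11) ∷ (d2 , bwd e08) ∷ []
neighbourhood p3 = (p2 , fwd e03) ∷ (p4 , fwd e04) ∷ (d2 , fwd e02) ∷ (d3 , fwd e01) ∷ []
neighbourhood p4 = (p3 , bwd e04) ∷ (p5 , fwd e13) ∷ (d3 , bwd e05) ∷ (d4 , fwd e14) ∷ []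
neighbourhood p5 = (p1 , bwd e23) ∷ (p4 , bwd e13) ∷ (d4 , fwd e25) ∷ (d5 , fwd e26) ∷ []
neighbourhood d1 = (p1 , fwd e21) ∷ (p2 , bwd e11) ∷ (v1 , fwd e22) ∷ (v2 , bwd e19) ∷ []
neighbourhood d2 = (p2 , fwd e08) ∷ (p3 , bwd e02) ∷ (v2 , fwd e10) ∷ (v3 , fwd e09) ∷ []
neighbourhood d3 = (p3 , bwd e01) ∷ (p4 , fwd e05) ∷ (v3 , fwd e07) ∷ (v4 , fwd e06) ∷ []
neighbourhood d4 = (p4 , bwd e14) ∷ (p5 , bwd e25) ∷ (v4 , bwd e16) ∷ (v5 , fwd e27) ∷ []
neighbourhood d5 = (p1 , bwd e24) ∷ (p5 , bwd e26) ∷ (w1 , fwd e32) ∷ (w3 , fwd e33) ∷ []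
neighbourhood v1 = (d1 , bwd e22) ∷ (v2 , bwd e20) ∷ (w2 , fwd e30) ∷ (w3 , fwd e31) ∷ []
neighbourhood v2 = (d1 , fwd e19) ∷ (d2 , bwd e10) ∷ (v1 , fwd e20) ∷ (v3 , bwd e18) ∷ []
neighbourhood v3 = (d2 , bwd e09) ∷ (d3 , bwd e07) ∷ (v2 , fwd e18) ∷ (v4 , bwd e15) ∷ []
neighbourhood v4 = (d3 , bwd e06) ∷ (d4 , fwd e16) ∷ (v3 , fwd e15) ∷ (v5 , fwd e17) ∷ []
neighbourhood v5 = (d4 , bwd e27) ∷ (v4 , bwd e17) ∷ (w1 , fwd e28) ∷ (w2 , fwd e29) ∷ []
neighbourhood w1 = (d5 , bwd e32) ∷ (v5 , bwd e28) ∷ []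
neighbourhood w2 = (v1 , bwd e30) ∷ (v5 , bwd e29) ∷ []
neighbourhood w3 = (d5 , bwd e33) ∷ (v1 , bwd e31) ∷ []

neighbours : V → List V
neighbours x = map proj₁ (neighbourhood x)

∈-neighbours⇒Adj : ∀ {x y} → y ∈ neighbours x → Adj x y
∈-neighbours⇒Adj y∈ with ∈-map⁻ proj₁ y∈
... | (_ , xy) , _ , refl = xy

Conflict : V → V → Set
Conflict x y = x ≢ y × ∃[ z ] (Adj x z × Adj y z)

ListedConflict : V → V → Set
ListedConflict x y = x ≢ y × Any (λ (z , _) → y ∈ neighbours z) (neighbourhood x)

listedConflict? : ∀ x y → Dec (ListedConflict x y)
listedConflict? x y = ¬? (x ≟ y) ×-dec Any.any? (λ (z , _) → y ∈? neighbours z) (neighbourhood x)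
  where open import Data.List.Membership.DecPropositional _≟_ using (_∈?_)

listed⇒conflict : ∀ {x y} → ListedConflict x y → Conflict x y
listed⇒conflict (x≢y , listed) with satisfied listed
... | (z , xz) , y∈ = x≢y , z , xz , Adj-sym (∈-neighbours⇒Adj y∈)

core : Fin 15 → V
core = lookup (take 15 vertices)

SomePair : (V → V → Set) → Fin 15 → Fin 15 → Fin 15 → Set
SomePair R i j l = R (core i) (core j) ⊎ R (core j) (core l) ⊎ R (core i) (core l)

core-triple-listed : ∀ i j l → i < j → j < l → SomePair ListedConflict i j l
core-triple-listed = from-yes (all? λ i → all? λ j → all? λ l →
  (i <? j) →-dec (j <? l) →-dec
  (listedConflict? (core i) (core j) ⊎-dec listedConflict? (core j) (core l) ⊎-dec
   listedConflict? (core i) (core l)))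

core-triple-conflict : ∀ {i j l} → i < j → j < l → SomePair Conflict i j l
core-triple-conflict {i} {j} {l} i<j j<l =
  Sum.map listed⇒conflict (Sum.map listed⇒conflict listed⇒conflict) (core-triple-listed i j l i<j j<l)

module _ {k : ℕ} {c : V → Fin k} (injective : IsInjectiveColouring k c) where

  conflict⇒colours-differ : ∀ {x y} → Conflict x y → c x ≢ c y
  conflict⇒colours-differ (x≢y , z , xz , yz) = injective _ _ z x≢y xz yz

  core-colouring-two-to-one : AtMostTwoToOne (c ∘ core)
  core-colouring-two-to-one {i} {j} {l} i<j j<l ci≡cj cj≡cl = clash (core-triple-conflict i<j j<l)
    where
    clash : SomePair Conflict i j l → ⊥
    clash (inj₁ conflict)        = conflict⇒colours-differ conflict ci≡cj
    clash (inj₂ (inj₁ conflict)) = conflict⇒colours-differ conflict cj≡cl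
    clash (inj₂ (inj₂ conflict)) = conflict⇒colours-differ conflict (trans ci≡cj cj≡cl)

lemma20 : (k : ℕ) → (c : V → Fin k) → IsInjectiveColouring k c → 8 ≤ k
lemma20 k c injective = 15≤2k⇒8≤k (atMostTwoToOne⇒≤ (c ∘ core) (core-colouring-two-to-one injective))
  where
  15≤2k⇒8≤k : 15 ≤ k * 2 → 8 ≤ k
  15≤2k⇒8≤k 15≤2k = ≮⇒≥ λ k<8 → <⇒≱ (s≤s (*-monoˡ-≤ 2 (≤-pred k<8))) 15≤2k
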